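{- Let $R$ be a Dedekind domain and let $I$ be a nonzero ideal of $R$ such that $R/I$ is finite and nontrivial. The graph $G_{R/I}$ is bipartite if and only if $Q(I)=2$.
   Context: $G_{R/I}$ is the unitary Cayley graph of $R/I$: vertex set $R/I$, with $a+I$, $b+I$ adjacent iff $a-b+I$ is a unit of $R/I$. $Q(I)$ is the minimum of $|R/P|$ over all prime ideals $P$ dividing $I$. -}

module Defs where

open import Level using (Level; _⊔_; suc)
open import Algebra.Bundles using (CommutativeRing)
open import Data.Nat using (ℕ)
open import Data.Fin using (Fin)
open import Data.Bool using (Bool)
open import Data.List using (List; foldr)
open import Data.List.Relation.Unary.All using (All)
open import Data.Product using (Σ; ∃; _×_; _,_)
open import Data.Sum using (_⊎_)
open import Relation.Nullary using (¬_)
open import Relation.Binary.PropositionalEquality using (_≡_; _≢_)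
open import Function.Bundles using (_⇔_)

module _ {c ℓ : Level} (R : CommutativeRing c ℓ) where
  open CommutativeRing R

  _−_ : Carrier → Carrier → Carrier
  x − y = x + (- y)

  record Ideal : Set (suc (c ⊔ ℓ)) where
    field
      mem   : Carrier → Set (c ⊔ ℓ)
      resp  : ∀ {x y} → x ≈ y → mem x → mem y
      mem-0 : mem 0#
      mem-+ : ∀ {x y} → mem x → mem y → mem (x + y)
      mem-* : ∀ r {x} → mem x → mem (r * x)
  open Ideal public

  _≡_mod_ : Carrier → Carrier → Ideal → Set (c ⊔ ℓ)
  x ≡ y mod I = mem I (x − y)

  IsUnitMod : Ideal → Carrier → Set (c ⊔ ℓ)
  IsUnitMod I x = ∃ λ u → (x * u) ≡ 1# mod I

  NonzeroIdeal : Ideal → Set (c ⊔ ℓ)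
  NonzeroIdeal I = ∃ λ x → mem I x × ¬ (x ≈ 0#)

  -- |R/I| = n : there are n representatives, hitting every coset exactly once
  QuotCard : Ideal → ℕ → Set (c ⊔ ℓ)
  QuotCard I n = Σ (Fin n → Carrier) λ f →
      (∀ x → ∃ λ i → x ≡ f i mod I)
    × (∀ i j → f i ≡ f j mod I → i ≡ j)

  FiniteNontrivialQuot : Ideal → Set (c ⊔ ℓ)
  FiniteNontrivialQuot I = ∃ λ n → QuotCard I n × (2 Data.Nat.≤ n)

  record IsPrimeIdeal (P : Ideal) : Set (c ⊔ ℓ) where
    field
      proper : ¬ mem P 1#
      prime  : ∀ a b → mem P (a * b) → mem P a ⊎ mem P b

  -- x belongs to the product ideal I·J (finite sums of products)
  ProdMem : Ideal → Ideal → Carrier → Set (c ⊔ ℓ)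
  ProdMem I J x = ∃ λ (ps : List (Carrier × Carrier)) →
      All (λ { (a , b) → mem I a × mem J b }) ps
    × (x ≈ foldr (λ { (a , b) s → (a * b) + s }) 0# ps)

  _∣ᴵ_ : Ideal → Ideal → Set (suc (c ⊔ ℓ))
  P ∣ᴵ I = ∃ λ (J : Ideal) → ∀ x → (mem I x ⇔ ProdMem P J x)

  -- Dedekind domain: an integral domain in which every nonzero ideal is
  -- invertible, i.e. I·J = aR for some ideal J and nonzero a.
  record IsDedekindDomain : Set (suc (c ⊔ ℓ)) where
    field
      nontrivial   : ¬ (1# ≈ 0#)
      noZeroDivs   : ∀ a b → (a * b) ≈ 0# → (a ≈ 0#) ⊎ (b ≈ 0#)
      invertible   : ∀ (I : Ideal) → NonzeroIdeal I →
        ∃ λ (J : Ideal) → ∃ λ a → ¬ (a ≈ 0#) ×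
          (∀ x → (ProdMem I J x ⇔ (∃ λ r → x ≈ (a * r))))

  -- The unitary Cayley graph G_{R/I} is bipartite: a 2-colouring of the
  -- vertex set R/I (a colouring of R constant on cosets) in which adjacent
  -- vertices (difference a unit of R/I) receive different colours.
  UnitaryCayleyBipartite : Ideal → Set (c ⊔ ℓ)
  UnitaryCayleyBipartite I = Σ (Carrier → Bool) λ col →
      (∀ x y → x ≡ y mod I → col x ≡ col y)
    × (∀ x y → IsUnitMod I (x − y) → col x ≢ col y)

  -- Q(I) = 2 : the minimum of |R/P| over primes P dividing I equals 2
  Q≡2 : Ideal → Set (suc (c ⊔ ℓ))
  Q≡2 I =
      (∃ λ (P : Ideal) → IsPrimeIdeal P × P ∣ᴵ I × QuotCard P 2)
    × (∀ (P : Ideal) n → IsPrimeIdeal P → P ∣ᴵ I → QuotCard P n → 2 Data.Nat.≤ n)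

module Submission where

-- A 2-colouring of the unitary Cayley graph of R/I admits no triangle, and 0, u, 1 form one as
-- soon as u and 1 − u are both units. Conversely, for a prime P ⊇ I with R/P = 𝔽₂, colouring x by
-- its residue mod P is proper, because a unit mod I lies outside P. It therefore suffices to show
-- that the finite ring R/I has 𝔽₂ as a residue field or contains such a u. This goes by
-- well-founded recursion over the ideals K ⊇ I. If every element outside K is a unit, R/K is a
-- field, and it is 𝔽₂ unless some u ∉ {0, 1} exists. Otherwise take a nonunit x ∉ K; by
-- pigeonhole some power e of x is idempotent mod K. If e ∈ K then x is nilpotent and units modulo
-- K + xR lift to units modulo K; if e, 1 − e ∉ K then R/K ≅ R/(K + eR) × R/(K + (1 − e)R) and
-- triangles glue by the Chinese remainder theorem; 1 − e ∈ K would make x a unit. Finally, in a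
-- Dedekind domain P ⊇ I implies P ∣ I (with quotient the colon ideal I ∶ P), which identifies the
-- primes in the definition of Q(I).

open import Level using (Level; _⊔_)
import Level
open import Algebra.Bundles using (CommutativeRing; RawRing)
open import Algebra.Solver.Ring.AlmostCommutativeRing
  using (fromCommutativeRing; _-Raw-AlmostCommutative⟶_)
open import Data.Bool using (Bool)
open import Data.Bool.Properties using (¬-not)
open import Data.Empty using (⊥-elim)
open import Data.Fin as Fin using (Fin; zero; suc)
import Data.Fin.Properties as Fin
open import Data.Fin.Subset using (Subset; _∈_; _⊃_)
open import Data.Fin.Subset.Induction using (⊃-wellFounded)
open import Data.List using (List; []; _∷_; foldr)
open import Data.List.Relation.Unary.All as All using (All; []; _∷_)
open import Data.Maybe using (Maybe; just; nothing)
open import Data.Nat as ℕ using (ℕ; zero; suc; _≤_; s≤s; z≤n)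
import Data.Nat.Properties as ℕ
open import Data.Nat.Tactic.RingSolver using (solve-∀)
open import Data.Product using (∃; _×_; _,_; proj₁; proj₂)
open import Data.Sum as Sum using (_⊎_; inj₁; inj₂; [_,_]′)
open import Data.Vec using (tabulate)
open import Data.Vec.Properties using (lookup∘tabulate; []=⇒lookup; lookup⇒[]=)
open import Function using (_∘_; id)
open import Function.Bundles using (_⇔_; mk⇔; Equivalence; Inverse; Injection)
open import Function.Properties.Inverse using (↔⇒↣)
open import Induction.WellFounded using (Acc; acc)
open import Relation.Binary.PropositionalEquality as ≡ using (_≡_; _≢_)
open import Relation.Nullary using (¬_; Dec; yes; no; does)
import Relation.Nullary.Decidable as Dec
open import Relation.Unary using (Decidable)
open import Defs hiding (_−_; _≡_mod_; IsUnitMod; _∣ᴵ_)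
import Defs

module CommutativeRingSolver {c ℓ : Level} (R : CommutativeRing c ℓ) where
  open CommutativeRing R hiding (zero)
  open import Algebra.Properties.Ring ring
    using (-0#≈0#; -‿involutive; -‿+-comm; -‿distribˡ-*; -‿distribʳ-*)
  open import Algebra.Properties.CommutativeSemigroup +-commutativeSemigroup using (interchange)
  open import Algebra.Properties.Semiring.Mult.TCOptimised semiring
    using (×-homo-+; ×1-homo-*) renaming (_×_ to _×ₙ_)
  open import Relation.Binary.Reasoning.Setoid setoid

  private
    -- A coefficient (a , b) stands for a − b; keeping one side zero makes normal forms unique.
    normalise : ℕ × ℕ → ℕ × ℕ
    normalise (suc a , suc b) = normalise (a , b)
    normalise p               = p

    ℤ-ring : RawRing _ _
    ℤ-ring = record
      { Carrier = ℕ × ℕ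
      ; _≈_     = _≡_
      ; _+_     = λ { (a , b) (c , d) → normalise (a ℕ.+ c , b ℕ.+ d) }
      ; _*_     = λ { (a , b) (c , d) → normalise (a ℕ.* c ℕ.+ b ℕ.* d , a ℕ.* d ℕ.+ b ℕ.* c) }
      ; -_      = λ { (a , b) → (b , a) }
      ; 0#      = (0 , 0)
      ; 1#      = (1 , 0)
      }

    diff : ℕ × ℕ → Carrier
    diff (a , b) = a ×ₙ 1# + - (b ×ₙ 1#)

    -- Nonnegative constants evaluate to a ×ₙ 1#, so that 0# and 1# appear literally in the
    -- equations produced by the solver.
    ⟦_⟧ : ℕ × ℕ → Carrier
    ⟦ a , zero ⟧  = a ×ₙ 1#
    ⟦ a , suc b ⟧ = diff (a , suc b)

    ⟦⟧≈diff : ∀ p → ⟦ p ⟧ ≈ diff p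
    ⟦⟧≈diff (a , zero)  = sym (trans (+-congˡ -0#≈0#) (+-identityʳ _))
    ⟦⟧≈diff (a , suc b) = refl

    −-+-cancelʳ : ∀ x y z → (x + z) + - (y + z) ≈ x + - y
    −-+-cancelʳ x y z = begin
      (x + z) + - (y + z)     ≈⟨ +-congˡ (-‿+-comm y z) ⟨
      (x + z) + (- y + - z)   ≈⟨ interchange x z (- y) (- z) ⟩
      (x + - y) + (z + - z)   ≈⟨ +-congˡ (-‿inverseʳ z) ⟩
      (x + - y) + 0#          ≈⟨ +-identityʳ _ ⟩
      x + - y                 ∎

    diff-cong : ∀ a b c d → a ℕ.+ d ≡ c ℕ.+ b → diff (a , b) ≈ diff (c , d)
    diff-cong a b c d a+d≡c+b = begin
      A + - B                       ≈⟨ −-+-cancelʳ A B D ⟨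
      (A + D) + - (B + D)           ≈⟨ +-cong (×-homo-+ 1# a d) (-‿cong (+-comm D B)) ⟨
      (a ℕ.+ d) ×ₙ 1# + - (D + B)   ≈⟨ +-congʳ (reflexive (≡.cong (_×ₙ 1#) a+d≡c+b)) ⟩
      (c ℕ.+ b) ×ₙ 1# + - (D + B)   ≈⟨ +-congʳ (×-homo-+ 1# c b) ⟩
      (C + B) + - (D + B)           ≈⟨ −-+-cancelʳ C D B ⟩
      C + - D                       ∎
      where A = a ×ₙ 1# ; B = b ×ₙ 1# ; C = c ×ₙ 1# ; D = d ×ₙ 1#

    ⟦normalise⟧ : ∀ a b → ⟦ normalise (a , b) ⟧ ≈ diff (a , b)
    ⟦normalise⟧ zero    b       = ⟦⟧≈diff (zero , b)
    ⟦normalise⟧ (suc a) zero    = ⟦⟧≈diff (suc a , zero)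
    ⟦normalise⟧ (suc a) (suc b) = trans (⟦normalise⟧ a b) (diff-cong a b (suc a) (suc b) (ℕ.+-suc a b))

    diff-+ : ∀ a b c d → diff (a ℕ.+ c , b ℕ.+ d) ≈ diff (a , b) + diff (c , d)
    diff-+ a b c d = begin
      (a ℕ.+ c) ×ₙ 1# + - ((b ℕ.+ d) ×ₙ 1#)   ≈⟨ +-cong (×-homo-+ 1# a c) (-‿cong (×-homo-+ 1# b d)) ⟩
      (A + C) + - (B + D)                     ≈⟨ +-congˡ (-‿+-comm B D) ⟨
      (A + C) + (- B + - D)                   ≈⟨ interchange A C (- B) (- D) ⟩
      (A + - B) + (C + - D)                   ∎
      where A = a ×ₙ 1# ; B = b ×ₙ 1# ; C = c ×ₙ 1# ; D = d ×ₙ 1#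

    diff-* : ∀ a b c d →
             diff (a ℕ.* c ℕ.+ b ℕ.* d , a ℕ.* d ℕ.+ b ℕ.* c) ≈ diff (a , b) * diff (c , d)
    diff-* a b c d = begin
      diff (a ℕ.* c ℕ.+ b ℕ.* d , a ℕ.* d ℕ.+ b ℕ.* c)
        ≈⟨ diff-+ (a ℕ.* c) (a ℕ.* d) (b ℕ.* d) (b ℕ.* c) ⟩
      diff (a ℕ.* c , a ℕ.* d) + diff (b ℕ.* d , b ℕ.* c)
        ≈⟨ +-cong (+-cong (×1-homo-* a c) (-‿cong (×1-homo-* a d)))
                  (+-cong (×1-homo-* b d) (-‿cong (×1-homo-* b c))) ⟩
      (A * C + - (A * D)) + (B * D + - (B * C))
        ≈⟨ +-cong (+-congˡ (-‿distribʳ-* A D)) (+-comm _ _) ⟩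
      (A * C + A * - D) + (- (B * C) + B * D)
        ≈⟨ +-cong (distribˡ A C (- D)) (+-cong (sym (-‿distribˡ-* B C)) (*-congʳ (-‿involutive B))) ⟨
      A * (C + - D) + (- B * C + - - B * D)
        ≈⟨ +-congˡ (+-congˡ (trans (sym (-‿distribˡ-* (- B) D)) (-‿distribʳ-* (- B) D))) ⟩
      A * (C + - D) + (- B * C + - B * - D)
        ≈⟨ +-congˡ (distribˡ (- B) C (- D)) ⟨
      A * (C + - D) + - B * (C + - D)
        ≈⟨ distribʳ (C + - D) A (- B) ⟨
      (A + - B) * (C + - D)
        ∎
      where A = a ×ₙ 1# ; B = b ×ₙ 1# ; C = c ×ₙ 1# ; D = d ×ₙ 1#

    diff-neg : ∀ a b → diff (b , a) ≈ - diff (a , b)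
    diff-neg a b = begin
      B + - A       ≈⟨ +-comm B (- A) ⟩
      - A + B       ≈⟨ +-congˡ (-‿involutive B) ⟨
      - A + - - B   ≈⟨ -‿+-comm A (- B) ⟩
      - (A + - B)   ∎
      where A = a ×ₙ 1# ; B = b ×ₙ 1#

    homomorphism : ℤ-ring -Raw-AlmostCommutative⟶ fromCommutativeRing R
    homomorphism = record
      { ⟦_⟧    = ⟦_⟧
      ; +-homo = λ { (a , b) (c , d) → trans (⟦normalise⟧ (a ℕ.+ c) (b ℕ.+ d))
                   (trans (diff-+ a b c d) (sym (+-cong (⟦⟧≈diff (a , b)) (⟦⟧≈diff (c , d))))) }
      ; *-homo = λ { (a , b) (c , d) → trans (⟦normalise⟧ (a ℕ.* c ℕ.+ b ℕ.* d) (a ℕ.* d ℕ.+ b ℕ.* c))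
                   (trans (diff-* a b c d) (sym (*-cong (⟦⟧≈diff (a , b)) (⟦⟧≈diff (c , d))))) }
      ; -‿homo = λ { (a , b) → trans (⟦⟧≈diff (b , a))
                   (trans (diff-neg a b) (-‿cong (sym (⟦⟧≈diff (a , b))))) }
      ; 0-homo = refl
      ; 1-homo = refl
      }

    _≟ℤ_ : ∀ p q → Maybe (⟦ p ⟧ ≈ ⟦ q ⟧)
    (a , b) ≟ℤ (c , d) with a ℕ.+ d ℕ.≟ c ℕ.+ b
    ... | yes a+d≡c+b = just (trans (⟦⟧≈diff (a , b))
                          (trans (diff-cong a b c d a+d≡c+b) (sym (⟦⟧≈diff (c , d)))))
    ... | no  _       = nothing

  open import Algebra.Solver.Ring ℤ-ring (fromCommutativeRing R) homomorphism _≟ℤ_ public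

  :0 :1 : ∀ {n} → Polynomial n
  :0 = con (0 , 0)
  :1 = con (1 , 0)

module _ {c ℓ : Level} (R : CommutativeRing c ℓ) where
  open CommutativeRing R hiding (zero)
  open CommutativeRingSolver R
  open import Algebra.Properties.Ring ring using (-1*x≈-x; x∙y⁻¹≈ε⇒x≈y)
  open import Algebra.Properties.CommutativeSemigroup *-commutativeSemigroup using (x∙yz≈y∙xz)
  open import Algebra.Properties.CommutativeSemiring.Exp commutativeSemiring
    using (_^_; ^-homo-*; ^-congʳ; ^-distrib-*)
  open import Relation.Binary.Reasoning.Setoid setoid

  infixl 6 _−_
  _−_ : Carrier → Carrier → Carrier
  _−_ = Defs._−_ R

  infix 4 _≡_mod_
  _≡_mod_ : Carrier → Carrier → Ideal R → Set (c ⊔ ℓ)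
  _≡_mod_ = Defs._≡_mod_ R

  IsUnitMod : Ideal R → Carrier → Set (c ⊔ ℓ)
  IsUnitMod = Defs.IsUnitMod R

  _∣ᴵ_ : Ideal R → Ideal R → Set (Level.suc (c ⊔ ℓ))
  _∣ᴵ_ = Defs._∣ᴵ_ R

  infix 4 _⊆_
  _⊆_ : Ideal R → Ideal R → Set (c ⊔ ℓ)
  K ⊆ L = ∀ {x} → mem K x → mem L x

  module _ (K : Ideal R) where

    mem-neg : ∀ {x} → mem K x → mem K (- x)
    mem-neg {x} x∈K = resp K (-1*x≈-x x) (mem-* K (- 1#) x∈K)

    mem-− : ∀ {x y} → mem K x → mem K y → mem K (x − y)
    mem-− x∈K y∈K = mem-+ K x∈K (mem-neg y∈K)

    mem-*ʳ : ∀ {x} r → mem K x → mem K (x * r)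
    mem-*ʳ r x∈K = resp K (*-comm r _) (mem-* K r x∈K)

    mem-≈0 : ∀ {x} → x ≈ 0# → mem K x
    mem-≈0 x≈0 = resp K (sym x≈0) (mem-0 K)

    ≡mod-sym : ∀ {x y} → x ≡ y mod K → y ≡ x mod K
    ≡mod-sym {x} {y} x≡y = resp K (solve 2 (λ x y → :- (x :- y) := y :- x) refl x y) (mem-neg x≡y)

    ≡mod-trans : ∀ {x y z} → x ≡ y mod K → y ≡ z mod K → x ≡ z mod K
    ≡mod-trans {x} {y} {z} x≡y y≡z =
      resp K (solve 3 (λ x y z → (x :- y) :+ (y :- z) := x :- z) refl x y z) (mem-+ K x≡y y≡z)

    1−-≡mod : ∀ {x y} → x ≡ y mod K → 1# − x ≡ 1# − y mod K
    1−-≡mod {x} {y} x≡y =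
      resp K (solve 2 (λ x y → :- (x :- y) := (:1 :- x) :- (:1 :- y)) refl x y) (mem-neg x≡y)

    mem-≡mod : ∀ {x y} → x ≡ y mod K → mem K x → mem K y
    mem-≡mod {x} {y} x≡y x∈K = resp K (solve 2 (λ x y → x :- (x :- y) := y) refl x y) (mem-− x∈K x≡y)

    ∉-≡mod : ∀ {x y} → x ≡ y mod K → ¬ mem K x → ¬ mem K y
    ∉-≡mod x≡y x∉K y∈K = x∉K (mem-≡mod (≡mod-sym x≡y) y∈K)

    unit-resp : ∀ {x y} → x ≈ y → IsUnitMod K x → IsUnitMod K y
    unit-resp x≈y (u , xu≡1) = u , resp K (+-congʳ (*-congʳ x≈y)) xu≡1

    unit-≡mod : ∀ {x y} → x ≡ y mod K → IsUnitMod K x → IsUnitMod K y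
    unit-≡mod {x} {y} x≡y (u , xu≡1) = u ,
      resp K (solve 3 (λ x y u → (x :* u :- :1) :- (x :- y) :* u := y :* u :- :1) refl x y u)
        (mem-− xu≡1 (mem-*ʳ u x≡y))

    ¬unit-≡mod : ∀ {x y} → x ≡ y mod K → ¬ IsUnitMod K x → ¬ IsUnitMod K y
    ¬unit-≡mod x≡y x-nonunit y-unit = x-nonunit (unit-≡mod (≡mod-sym x≡y) y-unit)

    unit-1 : IsUnitMod K 1#
    unit-1 = 1# , mem-≈0 (solve 0 (:1 :* :1 :- :1 := :0) refl)

    mem⇒¬unit : ¬ mem K 1# → ∀ {x} → mem K x → ¬ IsUnitMod K x
    mem⇒¬unit 1∉K {x} x∈K (u , xu≡1) = 1∉K
      (resp K (solve 2 (λ x u → x :* u :- (x :* u :- :1) := :1) refl x u) (mem-− (mem-*ʳ u x∈K) xu≡1))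

  infixl 6 _+⟨_⟩
  _+⟨_⟩ : Ideal R → Carrier → Ideal R
  K +⟨ g ⟩ = record
    { mem   = λ x → ∃ λ r → x ≡ g * r mod K
    ; resp  = λ { x≈y (r , x≡gr) → r , resp K (+-congʳ x≈y) x≡gr }
    ; mem-0 = 0# , mem-≈0 K (solve 1 (λ g → :0 :- g :* :0 := :0) refl g)
    ; mem-+ = λ { {x} {y} (r , x≡gr) (s , y≡gs) → r + s ,
        resp K (solve 5 (λ x y g r s → (x :- g :* r) :+ (y :- g :* s) := (x :+ y) :- g :* (r :+ s))
                        refl x y g r s)
          (mem-+ K x≡gr y≡gs) }
    ; mem-* = λ { t {x} (r , x≡gr) → t * r ,
        resp K (solve 4 (λ t x g r → t :* (x :- g :* r) := t :* x :- g :* (t :* r)) refl t x g r)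
          (mem-* K t x≡gr) }
    }

  ⊆-+⟨⟩ : ∀ (K : Ideal R) g → K ⊆ K +⟨ g ⟩
  ⊆-+⟨⟩ K g {x} x∈K = 0# , resp K (solve 2 (λ x g → x := x :- g :* :0) refl x g) x∈K

  generator∈+⟨⟩ : ∀ (K : Ideal R) g → mem (K +⟨ g ⟩) g
  generator∈+⟨⟩ K g = 1# , mem-≈0 K (solve 1 (λ g → g :- g :* :1 := :0) refl g)

  +⟨nonunit⟩-proper : ∀ (K : Ideal R) {g} → ¬ IsUnitMod K g → ¬ mem (K +⟨ g ⟩) 1#
  +⟨nonunit⟩-proper K g-nonunit (r , 1≡gr) = g-nonunit (r , ≡mod-sym K 1≡gr)

  -- 0, u and 1 are pairwise adjacent in the unitary Cayley graph of R/K.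
  Triangle : Ideal R → Set (c ⊔ ℓ)
  Triangle K = ∃ λ u → IsUnitMod K u × IsUnitMod K (1# − u)

  ResidueTwoPrimeOver : Ideal R → Set (Level.suc (c ⊔ ℓ))
  ResidueTwoPrimeOver K = ∃ λ P → IsPrimeIdeal R P × K ⊆ P × QuotCard R P 2

  TriangleOrResidueTwoPrime : Ideal R → Set (Level.suc (c ⊔ ℓ))
  TriangleOrResidueTwoPrime K = Triangle K ⊎ ResidueTwoPrimeOver K

  residueTwoPrimeOver-⊆ : ∀ (K L : Ideal R) → K ⊆ L → ResidueTwoPrimeOver L → ResidueTwoPrimeOver K
  residueTwoPrimeOver-⊆ K L K⊆L (P , prime , L⊆P , card) = P , prime , L⊆P ∘ K⊆L , card

  module Classes (K : Ideal R) {n} (card : QuotCard R K n) where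

    representative : Fin n → Carrier
    representative = proj₁ card

    class : Carrier → Fin n
    class x = proj₁ (proj₁ (proj₂ card) x)

    ≡mod-representative : ∀ x → x ≡ representative (class x) mod K
    ≡mod-representative x = proj₂ (proj₁ (proj₂ card) x)

    class-≡ : ∀ {x y} → x ≡ y mod K → class x ≡ class y
    class-≡ {x} {y} x≡y = proj₂ (proj₂ card) (class x) (class y)
      (≡mod-trans K (≡mod-sym K (≡mod-representative x)) (≡mod-trans K x≡y (≡mod-representative y)))

    ≡mod-class : ∀ {x y} → class x ≡ class y → x ≡ y mod K
    ≡mod-class {x} {y} eq = ≡mod-trans K (≡mod-representative x)
      (≡mod-sym K (≡.subst (λ i → y ≡ representative i mod K) (≡.sym eq) (≡mod-representative y)))

    mem? : Decidable (mem K)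
    mem? x = Dec.map′ (λ eq → resp K x−0≈x (≡mod-class eq)) (λ x∈K → class-≡ (resp K (sym x−0≈x) x∈K))
                      (class x Fin.≟ class 0#)
      where x−0≈x = solve 1 (λ x → x :- :0 := x) refl x

  quotCard-2≤ : ∀ (K : Ideal R) n → QuotCard R K n → ¬ mem K 1# → 2 ≤ n
  quotCard-2≤ K zero          card _   = ⊥-elim (Fin.¬Fin0 (Classes.class K card 0#))
  quotCard-2≤ K (suc zero)    card 1∉K =
    ⊥-elim (1∉K (resp K (solve 0 (:1 :- :0 := :1) refl) (≡mod-class (Fin1-≡ (class 1#) (class 0#)))))
    where
    open Classes K card
    Fin1-≡ : (i j : Fin 1) → i ≡ j
    Fin1-≡ zero zero = ≡.refl
  quotCard-2≤ K (suc (suc n)) _    _   = s≤s (s≤s z≤n)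

  quotCard-proper : ∀ (K : Ideal R) {n} → QuotCard R K n → 2 ≤ n → ¬ mem K 1#
  quotCard-proper K (representative , _ , distinct) (s≤s (s≤s _)) 1∈K = Fin.0≢1+n
    (distinct zero (suc zero)
      (resp K (*-identityʳ _) (mem-* K (representative zero − representative (suc zero)) 1∈K)))

  quotCard-2 : ∀ (K : Ideal R) → ¬ mem K 1# → (∀ x → mem K x ⊎ mem K (1# − x)) → QuotCard R K 2
  quotCard-2 K 1∉K dichotomy = representative , covers , distinct
    where
    representative : Fin 2 → Carrier
    representative zero    = 0#
    representative (suc _) = 1#
    covers : ∀ x → ∃ λ i → x ≡ representative i mod K
    covers x with dichotomy x
    ... | inj₁ x∈K   = zero , resp K (solve 1 (λ x → x := x :- :0) refl x) x∈K
    ... | inj₂ 1−x∈K = suc zero , ≡mod-sym K 1−x∈K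
    distinct : ∀ i j → representative i ≡ representative j mod K → i ≡ j
    distinct zero       zero       _   = ≡.refl
    distinct zero       (suc zero) 0≡1 =
      ⊥-elim (1∉K (resp K (solve 0 (:- (:0 :- :1) := :1) refl) (mem-neg K 0≡1)))
    distinct (suc zero) zero       1≡0 =
      ⊥-elim (1∉K (resp K (solve 0 (:1 :- :0 := :1) refl) 1≡0))
    distinct (suc zero) (suc zero) _   = ≡.refl

  maximal⇒prime : ∀ (K : Ideal R) → ¬ mem K 1# → (∀ x → mem K x ⊎ IsUnitMod K x) → IsPrimeIdeal R K
  maximal⇒prime K 1∉K maximal = record { proper = 1∉K ; prime = prime }
    where
    prime : ∀ a b → mem K (a * b) → mem K a ⊎ mem K b
    prime a b ab∈K = Sum.map₂ (λ { (u , au≡1) → resp K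
      (solve 3 (λ a b u → u :* (a :* b) :- b :* (a :* u :- :1) := b) refl a b u)
      (mem-− K (mem-* K u ab∈K) (mem-* K b au≡1)) }) (maximal a)

  -- Divisibility of ideals in a Dedekind domain

  sumProducts : List (Carrier × Carrier) → Carrier
  sumProducts = foldr (λ q s → proj₁ q * proj₂ q + s) 0#

  mem-sumProducts : ∀ (K : Ideal R) ps → All (λ q → mem K (proj₁ q * proj₂ q)) ps → mem K (sumProducts ps)
  mem-sumProducts K []       []           = mem-0 K
  mem-sumProducts K (q ∷ ps) (q∈K ∷ ps∈K) = mem-+ K q∈K (mem-sumProducts K ps ps∈K)

  prodMem⇒mem : ∀ (P J K : Ideal R) → (∀ {p j} → mem P p → mem J j → mem K (p * j)) →
                ∀ {x} → ProdMem R P J x → mem K x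
  prodMem⇒mem P J K products∈K (ps , factors , x≈∑) =
    resp K (sym x≈∑) (mem-sumProducts K ps (All.map (λ (p∈P , j∈J) → products∈K p∈P j∈J) factors))

  prodMem-single : ∀ (P J : Ideal R) {p j} → mem P p → mem J j → ProdMem R P J (p * j)
  prodMem-single P J p∈P j∈J = _ ∷ [] , (p∈P , j∈J) ∷ [] , sym (+-identityʳ _)

  ∣ᴵ⇒⊇ : ∀ (P I : Ideal R) → P ∣ᴵ I → I ⊆ P
  ∣ᴵ⇒⊇ P I (J , I≡PJ) x∈I =
    prodMem⇒mem P J P (λ p∈P _ → mem-*ʳ P _ p∈P) (Equivalence.to (I≡PJ _) x∈I)

  infix 7 _∶_
  _∶_ : Ideal R → Ideal R → Ideal R
  I ∶ P = record
    { mem   = λ r → ∀ {p} → mem P p → mem I (p * r)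
    ; resp  = λ x≈y Px⊆I p∈P → resp I (*-congˡ x≈y) (Px⊆I p∈P)
    ; mem-0 = λ {p} _ → mem-≈0 I (zeroʳ p)
    ; mem-+ = λ Px⊆I Py⊆I p∈P → resp I (sym (distribˡ _ _ _)) (mem-+ I (Px⊆I p∈P) (Py⊆I p∈P))
    ; mem-* = λ r {x} Px⊆I {p} p∈P → resp I (x∙yz≈y∙xz r p x) (mem-* I r (Px⊆I p∈P))
    }

  module _ (dedekind : IsDedekindDomain R) where
    open IsDedekindDomain dedekind

    *-cancelˡ-≉0 : ∀ {a x y} → ¬ a ≈ 0# → a * x ≈ a * y → x ≈ y
    *-cancelˡ-≉0 {a} {x} {y} a≉0 ax≈ay =
      [ ⊥-elim ∘ a≉0 , x∙y⁻¹≈ε⇒x≈y x y ]′ (noZeroDivs a (x − y) a[x−y]≈0)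
      where
      a[x−y]≈0 = trans (solve 3 (λ a x y → a :* (x :- y) := a :* x :- a :* y) refl a x y)
                   (trans (+-congʳ ax≈ay) (-‿inverseʳ _))

    -- Given P·J = αR, an x ∈ I ⊆ P becomes a sum of products p·r with r ∈ I ∶ P by dividing
    -- x·α = Σ p·(x·j) by α, where α = Σ p·j is expanded in P·J.
    module _ {I P J : Ideal R} {α} (α≉0 : ¬ α ≈ 0#)
             (PJ≡αR : ∀ y → ProdMem R P J y ⇔ (∃ λ r → y ≈ α * r))
             (I⊆P : I ⊆ P) {x} (x∈I : mem I x) where

      divide : ∀ {p j} → mem P p → mem J j → ∃ λ r → p * j ≈ α * r
      divide p∈P j∈J = Equivalence.to (PJ≡αR _) (prodMem-single P J p∈P j∈J)

      quotient∈colon : ∀ {j r} → mem J j → x * j ≈ α * r → mem (I ∶ P) r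
      quotient∈colon {j} {r} j∈J xj≈αr {q} q∈P with s , qj≈αs ← divide q∈P j∈J =
        resp I (sym (*-cancelˡ-≉0 α≉0 α[qr]≈α[xs])) (mem-*ʳ I s x∈I)
        where
        α[qr]≈α[xs] : α * (q * r) ≈ α * (x * s)
        α[qr]≈α[xs] = begin
          α * (q * r)   ≈⟨ x∙yz≈y∙xz α q r ⟩
          q * (α * r)   ≈⟨ *-congˡ xj≈αr ⟨
          q * (x * j)   ≈⟨ x∙yz≈y∙xz q x j ⟩
          x * (q * j)   ≈⟨ *-congˡ qj≈αs ⟩
          x * (α * s)   ≈⟨ x∙yz≈y∙xz x α s ⟩
          α * (x * s)   ∎

      rescale : ∀ ps → All (λ q → mem P (proj₁ q) × mem J (proj₂ q)) ps →
        ∃ λ ps′ → All (λ q → mem P (proj₁ q) × mem (I ∶ P) (proj₂ q)) ps′ ×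
                  α * sumProducts ps′ ≈ x * sumProducts ps
      rescale [] [] = [] , [] , trans (zeroʳ α) (sym (zeroʳ x))
      rescale ((p , j) ∷ ps) ((p∈P , j∈J) ∷ factors)
        with r , xj≈αr ← divide (I⊆P x∈I) j∈J
           | ps′ , factors′ , α∑′≈x∑ ← rescale ps factors
        = (p , r) ∷ ps′ , (p∈P , quotient∈colon j∈J xj≈αr) ∷ factors′ , (begin
          α * (p * r + sumProducts ps′)       ≈⟨ distribˡ α _ _ ⟩
          α * (p * r) + α * sumProducts ps′   ≈⟨ +-cong (x∙yz≈y∙xz α p r) α∑′≈x∑ ⟩
          p * (α * r) + x * sumProducts ps    ≈⟨ +-congʳ (*-congˡ xj≈αr) ⟨
          p * (x * j) + x * sumProducts ps    ≈⟨ +-congʳ (x∙yz≈y∙xz p x j) ⟩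
          x * (p * j) + x * sumProducts ps    ≈⟨ distribˡ x _ _ ⟨
          x * (p * j + sumProducts ps)        ∎)

    ⊇⇒∣ᴵ : ∀ (I P : Ideal R) → NonzeroIdeal R I → I ⊆ P → P ∣ᴵ I
    ⊇⇒∣ᴵ I P (z , z∈I , z≉0) I⊆P =
      I ∶ P , λ x → mk⇔ (prodMem-colon x) (prodMem⇒mem P (I ∶ P) I (λ p∈P r∈I∶P → r∈I∶P p∈P))
      where
      prodMem-colon : ∀ x → mem I x → ProdMem R P (I ∶ P) x
      prodMem-colon x x∈I
        with J , α , α≉0 , PJ≡αR ← invertible P (z , I⊆P z∈I , z≉0)
        with ps , factors , α≈∑ ← Equivalence.from (PJ≡αR α) (1# , sym (*-identityʳ α))
        with ps′ , factors′ , α∑′≈x∑ ← rescale {I} {P} {J} α≉0 PJ≡αR I⊆P x∈I ps factors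
        = ps′ , factors′ , *-cancelˡ-≉0 α≉0 (begin
          α * x                 ≈⟨ *-comm α x ⟩
          x * α                 ≈⟨ *-congˡ α≈∑ ⟩
          x * sumProducts ps    ≈⟨ α∑′≈x∑ ⟨
          α * sumProducts ps′   ∎)

  -- Nilpotents and idempotents

  geometricSum : Carrier → ℕ → Carrier
  geometricSum y zero    = 0#
  geometricSum y (suc m) = 1# + y * geometricSum y m

  geometricSum-telescopes : ∀ y m → (1# − y) * geometricSum y m ≈ 1# − y ^ m
  geometricSum-telescopes y zero    = solve 1 (λ y → (:1 :- y) :* :0 := :1 :- :1) refl y
  geometricSum-telescopes y (suc m) = begin
    (1# − y) * (1# + y * g)
      ≈⟨ solve 2 (λ y g → (:1 :- y) :* (:1 :+ y :* g) := (:1 :- y) :+ y :* ((:1 :- y) :* g)) refl y g ⟩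
    (1# − y) + y * ((1# − y) * g)
      ≈⟨ +-congˡ (*-congˡ (geometricSum-telescopes y m)) ⟩
    (1# − y) + y * (1# − y ^ m)
      ≈⟨ solve 2 (λ y p → (:1 :- y) :+ y :* (:1 :- p) := :1 :- y :* p) refl y (y ^ m) ⟩
    1# − y * y ^ m
      ∎
    where g = geometricSum y m

  unit-1−nilpotent : ∀ (K : Ideal R) {y} m → mem K (y ^ m) → IsUnitMod K (1# − y)
  unit-1−nilpotent K {y} m y^m∈K = geometricSum y m , resp K
    (sym (trans (+-congʳ (geometricSum-telescopes y m))
                (solve 1 (λ p → (:1 :- p) :- :1 := :- p) refl (y ^ m))))
    (mem-neg K y^m∈K)

  unit-lift-nilpotent : ∀ (K : Ideal R) {x u} m → mem K (x ^ m) → IsUnitMod (K +⟨ x ⟩) u → IsUnitMod K u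
  unit-lift-nilpotent K {x} {u} m x^m∈K (v , r , uv−1≡xr)
    with w , [1+xr]w≡1 ← unit-1−nilpotent K m (resp K (sym (^-distrib-* x (- r) m)) (mem-*ʳ K _ x^m∈K)) =
    v * w , resp K (solve 5 (λ u v w x r → w :* ((u :* v :- :1) :- x :* r) :+ ((:1 :- x :* (:- r)) :* w :- :1)
                                           := u :* (v :* w) :- :1) refl u v w x r)
              (mem-+ K (mem-* K w uv−1≡xr) [1+xr]w≡1)

  triangleOrResidueTwoPrime-lift-nilpotent : ∀ (K : Ideal R) {x} m → mem K (x ^ m) →
    TriangleOrResidueTwoPrime (K +⟨ x ⟩) → TriangleOrResidueTwoPrime K
  triangleOrResidueTwoPrime-lift-nilpotent K {x} m x^m∈K = Sum.map
    (λ (u , u-unit , 1−u-unit) →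
       u , unit-lift-nilpotent K m x^m∈K u-unit , unit-lift-nilpotent K m x^m∈K 1−u-unit)
    (residueTwoPrimeOver-⊆ K (K +⟨ x ⟩) (⊆-+⟨⟩ K x))

  IsIdempotentMod : Ideal R → Carrier → Set (c ⊔ ℓ)
  IsIdempotentMod K e = e * e ≡ e mod K

  module _ (K : Ideal R) {e} (idempotent : IsIdempotentMod K e) where

    idempotent-complement : IsIdempotentMod K (1# − e)
    idempotent-complement =
      resp K (solve 1 (λ e → e :* e :- e := (:1 :- e) :* (:1 :- e) :- (:1 :- e)) refl e) idempotent

    +⟨idempotent⟩-proper : ¬ mem K (1# − e) → ¬ mem (K +⟨ e ⟩) 1#
    +⟨idempotent⟩-proper 1−e∉K (r , 1≡er) = 1−e∉K
      (resp K (solve 2 (λ e r → (:1 :- e) :* (:1 :- e :* r) :- r :* (e :* e :- e) := :1 :- e) refl e r)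
        (mem-− K (mem-* K (1# − e) 1≡er) (mem-* K r idempotent)))

    unit-crt : ∀ {a b} → IsUnitMod (K +⟨ e ⟩) a → IsUnitMod (K +⟨ 1# − e ⟩) b →
               IsUnitMod K ((1# − e) * a + e * b)
    unit-crt {a} {b} (v , r , av−1≡er) (w , s , bw−1≡[1−e]s) = (1# − e) * v + e * w ,
      resp K (solve 7 (λ e a b v w r s →
                 (:1 :- e) :* ((a :* v :- :1) :- e :* r) :+ e :* ((b :* w :- :1) :- (:1 :- e) :* s)
                 :+ (e :* e :- e) :* ((a :- b) :* (v :- w) :- r :- s)
                 := ((:1 :- e) :* a :+ e :* b) :* ((:1 :- e) :* v :+ e :* w) :- :1) refl e a b v w r s)
        (mem-+ K (mem-+ K (mem-* K (1# − e) av−1≡er) (mem-* K e bw−1≡[1−e]s)) (mem-*ʳ K _ idempotent))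

    triangle-crt : Triangle (K +⟨ e ⟩) → Triangle (K +⟨ 1# − e ⟩) → Triangle K
    triangle-crt (u , u-unit , 1−u-unit) (u′ , u′-unit , 1−u′-unit) =
      (1# − e) * u + e * u′ , unit-crt u-unit u′-unit ,
      unit-resp K (solve 3 (λ e u u′ → (:1 :- e) :* (:1 :- u) :+ e :* (:1 :- u′)
                                     := :1 :- ((:1 :- e) :* u :+ e :* u′)) refl e u u′)
        (unit-crt 1−u-unit 1−u′-unit)

    triangleOrResidueTwoPrime-crt : TriangleOrResidueTwoPrime (K +⟨ e ⟩) →
      TriangleOrResidueTwoPrime (K +⟨ 1# − e ⟩) → TriangleOrResidueTwoPrime K
    triangleOrResidueTwoPrime-crt (inj₁ t) (inj₁ t′) = inj₁ (triangle-crt t t′)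
    triangleOrResidueTwoPrime-crt (inj₂ p) _        =
      inj₂ (residueTwoPrimeOver-⊆ K (K +⟨ e ⟩) (⊆-+⟨⟩ K e) p)
    triangleOrResidueTwoPrime-crt _        (inj₂ p) =
      inj₂ (residueTwoPrimeOver-⊆ K (K +⟨ 1# − e ⟩) (⊆-+⟨⟩ K (1# − e)) p)

  powers-periodic : ∀ (K : Ideal R) x a d → x ^ (d ℕ.+ a) ≡ x ^ a mod K →
                    ∀ k → x ^ (k ℕ.* d ℕ.+ a) ≡ x ^ a mod K
  powers-periodic K x a d period zero    = mem-≈0 K (-‿inverseʳ _)
  powers-periodic K x a d period (suc k) =
    ≡mod-trans K (resp K shift (mem-* K (x ^ d) (powers-periodic K x a d period k))) period
    where
    shift : x ^ d * (x ^ (k ℕ.* d ℕ.+ a) − x ^ a) ≈ x ^ (suc k ℕ.* d ℕ.+ a) − x ^ (d ℕ.+ a)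
    shift = begin
      x ^ d * (x ^ (k ℕ.* d ℕ.+ a) − x ^ a)
        ≈⟨ solve 3 (λ p q r → p :* (q :- r) := p :* q :- p :* r) refl _ _ _ ⟩
      x ^ d * x ^ (k ℕ.* d ℕ.+ a) − x ^ d * x ^ a
        ≈⟨ +-cong (^-homo-* x d _) (-‿cong (^-homo-* x d a)) ⟨
      x ^ (d ℕ.+ (k ℕ.* d ℕ.+ a)) − x ^ (d ℕ.+ a)
        ≈⟨ +-congʳ (^-congʳ x (ℕ.+-assoc d (k ℕ.* d) a)) ⟨
      x ^ (suc k ℕ.* d ℕ.+ a) − x ^ (d ℕ.+ a)
        ∎

  -- With period D = suc d from a on, x ^ N is idempotent for N = (a + 1) · D,
  -- written here as j + a with j = suc (d + a · d).
  periodic⇒idempotentPower : ∀ (K : Ideal R) x a d → x ^ (suc d ℕ.+ a) ≡ x ^ a mod K →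
                             ∃ λ N → IsIdempotentMod K (x ^ suc N)
  periodic⇒idempotentPower K x a d period =
    d ℕ.+ a ℕ.* d ℕ.+ a , resp K shift (mem-* K (x ^ j) (powers-periodic K x a (suc d) period (suc a)))
    where
    j = suc (d ℕ.+ a ℕ.* d)
    N = j ℕ.+ a
    N+N≡j+[[a+1]D+a] : N ℕ.+ N ≡ j ℕ.+ (suc a ℕ.* suc d ℕ.+ a)
    N+N≡j+[[a+1]D+a] = arithmetic a d
      where
      arithmetic : ∀ a d → let N = suc (d ℕ.+ a ℕ.* d) ℕ.+ a in
                   N ℕ.+ N ≡ suc (d ℕ.+ a ℕ.* d) ℕ.+ (suc a ℕ.* suc d ℕ.+ a)
      arithmetic = solve-∀
    shift : x ^ j * (x ^ (suc a ℕ.* suc d ℕ.+ a) − x ^ a) ≈ x ^ N * x ^ N − x ^ N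
    shift = begin
      x ^ j * (x ^ (suc a ℕ.* suc d ℕ.+ a) − x ^ a)
        ≈⟨ solve 3 (λ p q r → p :* (q :- r) := p :* q :- p :* r) refl _ _ _ ⟩
      x ^ j * x ^ (suc a ℕ.* suc d ℕ.+ a) − x ^ j * x ^ a
        ≈⟨ +-cong (^-homo-* x j _) (-‿cong (^-homo-* x j a)) ⟨
      x ^ (j ℕ.+ (suc a ℕ.* suc d ℕ.+ a)) − x ^ N
        ≈⟨ +-congʳ (^-congʳ x N+N≡j+[[a+1]D+a]) ⟨
      x ^ (N ℕ.+ N) − x ^ N
        ≈⟨ +-congʳ (^-homo-* x N N) ⟩
      x ^ N * x ^ N − x ^ N
        ∎

  -- Ideals containing an ideal of finite index

  module FiniteQuotient (I : Ideal R) {n} (card : QuotCard R I n) where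
    open Classes I card

    module _ (K : Ideal R) (I⊆K : I ⊆ K) where

      ∃-representatives? : ∀ {p} {P : Carrier → Set p} → (∀ {x y} → x ≡ y mod K → P x → P y) →
                           (∀ i → Dec (P (representative i))) → Dec (∃ P)
      ∃-representatives? resp-P P? = Dec.map′ (λ (i , Pi) → representative i , Pi)
        (λ (x , Px) → class x , resp-P (I⊆K (≡mod-representative x)) Px) (Fin.any? P?)

      module _ (∈K? : Decidable (mem K)) where

        unit? : Decidable (IsUnitMod K)
        unit? x = ∃-representatives?
          (λ {u} {v} u≡v xu≡1 → resp K
            (solve 3 (λ x u v → (x :* u :- :1) :- x :* (u :- v) := x :* v :- :1) refl x u v)
            (mem-− K xu≡1 (mem-* K x u≡v)))
          (λ i → ∈K? (x * representative i − 1#))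

        +⟨⟩? : ∀ g → Decidable (mem (K +⟨ g ⟩))
        +⟨⟩? g x = ∃-representatives?
          (λ {r} {s} r≡s x≡gr → resp K
            (solve 4 (λ x g r s → (x :- g :* r) :+ g :* (r :- s) := x :- g :* s) refl x g r s)
            (mem-+ K x≡gr (mem-* K g r≡s)))
          (λ i → ∈K? (x − g * representative i))

      finite⇒idempotentPower : ∀ x → ∃ λ N → IsIdempotentMod K (x ^ suc N)
      finite⇒idempotentPower x
        with i , j , i<j , same ← Fin.pigeonhole (ℕ.n<1+n n) (λ k → class (x ^ Fin.toℕ k)) =
        periodic⇒idempotentPower K x a d
          (I⊆K (resp I (+-congʳ (^-congʳ x b≡1+d+a)) (≡mod-class (≡.sym same))))
        where
        a = Fin.toℕ i
        d = Fin.toℕ j ℕ.∸ suc a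
        b≡1+d+a : Fin.toℕ j ≡ suc d ℕ.+ a
        b≡1+d+a = ≡.trans (≡.sym (ℕ.m∸n+n≡m i<j)) (ℕ.+-suc d a)

    -- The representatives lying in K; the recursion below makes this subset grow strictly.
    trace : ∀ (K : Ideal R) → Decidable (mem K) → Subset n
    trace K ∈K? = tabulate (λ i → does (∈K? (representative i)))

    ∈-trace⁺ : ∀ (K : Ideal R) (∈K? : Decidable (mem K)) {i} → mem K (representative i) → i ∈ trace K ∈K?
    ∈-trace⁺ K ∈K? {i} rᵢ∈K =
      lookup⇒[]= i _ (≡.trans (lookup∘tabulate _ i) (Dec.dec-true (∈K? _) rᵢ∈K))

    ∈-trace⁻ : ∀ (K : Ideal R) (∈K? : Decidable (mem K)) {i} → i ∈ trace K ∈K? → mem K (representative i)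
    ∈-trace⁻ K ∈K? {i} i∈trace
      with ∈K? (representative i) | ≡.trans (≡.sym (lookup∘tabulate _ i)) ([]=⇒lookup i∈trace)
    ... | yes rᵢ∈K | _ = rᵢ∈K
    ... | no _     | ()

    trace-⊂ : ∀ (K L : Ideal R) (∈K? : Decidable (mem K)) (∈L? : Decidable (mem L)) → I ⊆ K → K ⊆ L →
              ∀ {x} → mem L x → ¬ mem K x → trace L ∈L? ⊃ trace K ∈K?
    trace-⊂ K L ∈K? ∈L? I⊆K K⊆L {x} x∈L x∉K =
      (λ i∈K → ∈-trace⁺ L ∈L? (K⊆L (∈-trace⁻ K ∈K? i∈K))) ,
      class x ,
      ∈-trace⁺ L ∈L? (mem-≡mod L (K⊆L (I⊆K (≡mod-representative x))) x∈L) ,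
      λ i∈K → x∉K (mem-≡mod K (≡mod-sym K (I⊆K (≡mod-representative x))) (∈-trace⁻ K ∈K? i∈K))

    maximal⇒triangleOrResidueTwoPrime : ∀ (K : Ideal R) → I ⊆ K → Decidable (mem K) → ¬ mem K 1# →
      (∀ x → mem K x ⊎ IsUnitMod K x) → TriangleOrResidueTwoPrime K
    maximal⇒triangleOrResidueTwoPrime K I⊆K ∈K? 1∉K maximal = decide (∃-representatives? K I⊆K
      (λ x≡y (x∉K , 1−x∉K) → ∉-≡mod K x≡y x∉K , ∉-≡mod K (1−-≡mod K x≡y) 1−x∉K)
      (λ i → Dec.¬? (∈K? (representative i)) Dec.×-dec Dec.¬? (∈K? (1# − representative i))))
      where
      unit-∉ : ∀ {x} → ¬ mem K x → IsUnitMod K x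
      unit-∉ {x} x∉K = [ ⊥-elim ∘ x∉K , id ]′ (maximal x)
      decide : Dec (∃ λ x → ¬ mem K x × ¬ mem K (1# − x)) → TriangleOrResidueTwoPrime K
      decide (yes (u , u∉K , 1−u∉K)) = inj₁ (u , unit-∉ u∉K , unit-∉ 1−u∉K)
      decide (no ¬∃) = inj₂ (K , maximal⇒prime K 1∉K maximal , id , quotCard-2 K 1∉K dichotomy)
        where
        dichotomy : ∀ x → mem K x ⊎ mem K (1# − x)
        dichotomy x with ∈K? x | ∈K? (1# − x)
        ... | yes x∈K | _         = inj₁ x∈K
        ... | no _    | yes 1−x∈K = inj₂ 1−x∈K
        ... | no x∉K  | no 1−x∉K  = ⊥-elim (¬∃ (x , x∉K , 1−x∉K))

    nonunit⇒triangleOrResidueTwoPrime : ∀ (K : Ideal R) → Decidable (mem K) →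
      (∀ g → ¬ mem K g → ¬ mem (K +⟨ g ⟩) 1# → TriangleOrResidueTwoPrime (K +⟨ g ⟩)) →
      ∀ {x} → ¬ mem K x → ¬ IsUnitMod K x → (∃ λ N → IsIdempotentMod K (x ^ suc N)) →
      TriangleOrResidueTwoPrime K
    nonunit⇒triangleOrResidueTwoPrime K ∈K? recurse {x} x∉K x-nonunit (N , idempotent)
      with ∈K? (x ^ suc N) | ∈K? (1# − x ^ suc N)
    ... | yes e∈K | _ = triangleOrResidueTwoPrime-lift-nilpotent K (suc N) e∈K
                          (recurse x x∉K (+⟨nonunit⟩-proper K x-nonunit))
    ... | no _    | yes 1−e∈K = ⊥-elim (x-nonunit (x ^ N ,
          resp K (solve 1 (λ e → :- (:1 :- e) := e :- :1) refl (x ^ suc N)) (mem-neg K 1−e∈K)))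
    ... | no e∉K  | no 1−e∉K = triangleOrResidueTwoPrime-crt K idempotent
          (recurse e e∉K (+⟨idempotent⟩-proper K idempotent 1−e∉K))
          (recurse (1# − e) 1−e∉K (+⟨idempotent⟩-proper K (idempotent-complement K idempotent)
             (e∉K ∘ resp K (solve 1 (λ e → :1 :- (:1 :- e) := e) refl e))))
      where e = x ^ suc N

    triangleOrResidueTwoPrime : ∀ (K : Ideal R) → I ⊆ K → (∈K? : Decidable (mem K)) → ¬ mem K 1# →
      Acc _⊃_ (trace K ∈K?) → TriangleOrResidueTwoPrime K
    triangleOrResidueTwoPrime K I⊆K ∈K? 1∉K (acc smaller) = decide (∃-representatives? K I⊆K
      (λ x≡y (x∉K , x-nonunit) → ∉-≡mod K x≡y x∉K , ¬unit-≡mod K x≡y x-nonunit)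
      (λ i → Dec.¬? (∈K? (representative i)) Dec.×-dec Dec.¬? (unit? K I⊆K ∈K? (representative i))))
      where
      recurse : ∀ g → ¬ mem K g → ¬ mem (K +⟨ g ⟩) 1# → TriangleOrResidueTwoPrime (K +⟨ g ⟩)
      recurse g g∉K 1∉K+g =
        triangleOrResidueTwoPrime (K +⟨ g ⟩) (⊆-+⟨⟩ K g ∘ I⊆K) (+⟨⟩? K I⊆K ∈K? g) 1∉K+g (smaller
          (trace-⊂ K (K +⟨ g ⟩) ∈K? (+⟨⟩? K I⊆K ∈K? g) I⊆K (⊆-+⟨⟩ K g) (generator∈+⟨⟩ K g) g∉K))
      decide : Dec (∃ λ x → ¬ mem K x × ¬ IsUnitMod K x) → TriangleOrResidueTwoPrime K
      decide (yes (x , x∉K , x-nonunit)) = nonunit⇒triangleOrResidueTwoPrime K ∈K? recurse x∉K x-nonunit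
                                             (finite⇒idempotentPower K I⊆K x)
      decide (no ¬∃) = maximal⇒triangleOrResidueTwoPrime K I⊆K ∈K? 1∉K maximal
        where
        maximal : ∀ x → mem K x ⊎ IsUnitMod K x
        maximal x with ∈K? x | unit? K I⊆K ∈K? x
        ... | yes x∈K | _            = inj₁ x∈K
        ... | no _    | yes x-unit   = inj₂ x-unit
        ... | no x∉K  | no x-nonunit = ⊥-elim (¬∃ (x , x∉K , x-nonunit))

    finite⇒triangleOrResidueTwoPrime : 2 ≤ n → TriangleOrResidueTwoPrime I
    finite⇒triangleOrResidueTwoPrime 2≤n =
      triangleOrResidueTwoPrime I id mem? (quotCard-proper I card 2≤n) (⊃-wellFounded _)

  bipartite⇒¬triangle : ∀ (I : Ideal R) → UnitaryCayleyBipartite R I → ¬ Triangle I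
  bipartite⇒¬triangle I (_ , _ , adjacent⇒≢) (u , u-unit , 1−u-unit) =
    1≢0 (≡.trans (¬-not 1≢u) (≡.sym (¬-not (u≢0 ∘ ≡.sym))))
    where
    u≢0 = adjacent⇒≢ u 0# (unit-resp I (solve 1 (λ u → u := u :- :0) refl u) u-unit)
    1≢u = adjacent⇒≢ 1# u 1−u-unit
    1≢0 = adjacent⇒≢ 1# 0# (unit-resp I (solve 0 (:1 := :1 :- :0) refl) (unit-1 I))

  residueTwoPrime⇒bipartite : ∀ (I : Ideal R) → ResidueTwoPrimeOver I → UnitaryCayleyBipartite R I
  residueTwoPrime⇒bipartite I (P , prime , I⊆P , card) = colour , colour-≡ , adjacent⇒≢
    where
    open Classes P card
    colour : Carrier → Bool
    colour = Inverse.to Fin.2↔Bool ∘ class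
    colour-≡ : ∀ x y → x ≡ y mod I → colour x ≡ colour y
    colour-≡ x y x≡y = ≡.cong (Inverse.to Fin.2↔Bool) (class-≡ (I⊆P x≡y))
    adjacent⇒≢ : ∀ x y → IsUnitMod I (x − y) → colour x ≢ colour y
    adjacent⇒≢ x y (u , [x−y]u≡1) same = mem⇒¬unit P (IsPrimeIdeal.proper prime)
      (≡mod-class (Injection.injective (↔⇒↣ Fin.2↔Bool) same)) (u , I⊆P [x−y]u≡1)

  Q≡2⇒residueTwoPrime : ∀ (I : Ideal R) → Q≡2 R I → ResidueTwoPrimeOver I
  Q≡2⇒residueTwoPrime I ((P , prime , P∣I , card) , _) = P , prime , ∣ᴵ⇒⊇ P I P∣I , card

  residueTwoPrime⇒Q≡2 : IsDedekindDomain R → ∀ (I : Ideal R) → NonzeroIdeal R I →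
                        ResidueTwoPrimeOver I → Q≡2 R I
  residueTwoPrime⇒Q≡2 dedekind I I≢0 (P , prime , I⊆P , card) =
    (P , prime , ⊇⇒∣ᴵ dedekind I P I≢0 I⊆P , card) ,
    λ P′ m prime′ _ card′ → quotCard-2≤ P′ m card′ (IsPrimeIdeal.proper prime′)

theorem4p2 : ∀ {c ℓ : Level} (R : CommutativeRing c ℓ) → IsDedekindDomain R →
    (I : Ideal R) → NonzeroIdeal R I → FiniteNontrivialQuot R I →
    (UnitaryCayleyBipartite R I ⇔ Q≡2 R I)
theorem4p2 R dedekind I I≢0 (n , card , 2≤n) = mk⇔
  (λ bipartite → [ ⊥-elim ∘ bipartite⇒¬triangle R I bipartite , residueTwoPrime⇒Q≡2 R dedekind I I≢0 ]′
                   (FiniteQuotient.finite⇒triangleOrResidueTwoPrime R I card 2≤n))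
  (residueTwoPrime⇒bipartite R I ∘ Q≡2⇒residueTwoPrime R I)
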